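{- For $n\ge1$ let $f_{n,i}$ be the coefficient of $x^i$ in $(1+x+x^2)^n$. Then for all sufficiently large $n$, \[ 2f_{n,0}+\sum_{i=1}^{\lfloor n/2\rfloor} f_{n,i}-f_{n,n}<0 . \]
   Context: $\lfloor x\rfloor$ denotes the integer part of $x$. -}

module Defs where

open import Data.Nat using (ℕ; zero; suc; _+_; _*_; _/_)
open import Data.List using (List; []; _∷_; map)
open import Data.Integer as ℤ using (ℤ; +_)

-- Polynomials with natural-number coefficients as coefficient lists
-- (head = constant term).
Poly : Set
Poly = List ℕ

_⊕_ : Poly → Poly → Poly
[] ⊕ q = q
(a ∷ p) ⊕ [] = a ∷ p
(a ∷ p) ⊕ (b ∷ q) = (a + b) ∷ (p ⊕ q)

_⊗_ : Poly → Poly → Poly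
[] ⊗ q = []
(a ∷ p) ⊗ q = map (a *_) q ⊕ (0 ∷ (p ⊗ q))

_^ᵖ_ : Poly → ℕ → Poly
p ^ᵖ zero = 1 ∷ []
p ^ᵖ suc n = p ⊗ (p ^ᵖ n)

coeff : Poly → ℕ → ℕ
coeff [] i = 0
coeff (a ∷ p) zero = a
coeff (a ∷ p) (suc i) = coeff p i

trin : Poly
trin = 1 ∷ 1 ∷ 1 ∷ []

f : ℕ → ℕ → ℕ
f n i = coeff (trin ^ᵖ n) i

sum1to : (ℕ → ℕ) → ℕ → ℕ
sum1to g zero = 0
sum1to g (suc m) = sum1to g m + g (suc m)

expr : ℕ → ℤ
expr n = (+ (2 * f n 0 + sum1to (f n) (n / 2))) ℤ.- (+ f n n)

-- Evaluating the generating function at x = 1/2 bounds the left part: Σ_{i ≤ m} f_{n,i}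
-- ≤ 2^m (1 + 1/2 + 1/4)^n = 2^m (7/4)^n, which for m = ⌊n/2⌋ is O((7√2/4)^n) ≈ O(2.47^n).
-- On the other side, the weights (1,2,3,3,3,2,1) form a sub-eigenvector, with eigenvalue 8/3,
-- of the trinomial recurrence f_{n+1,i} = f_{n,i} + f_{n,i-1} + f_{n,i-2}; starting from the
-- coefficients of (1+x+x²)³ this gives f_{n,n} ≥ 3 (8/3)^(n-3). As 2 (7/4)² < (8/3)², i.e.
-- 882 < 1024, the central coefficient eventually wins; comparing squares disposes of the √2.
module Submission where

open import Defs
open import Data.Nat using (ℕ; _≥_)
open import Data.Integer using (_<_; +_)
open import Data.Product using (∃-syntax)

open import Data.Nat using (zero; suc; _+_; _*_; _^_; _≤_; _∸_; _/_; z≤n; NonZero)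
import Data.Nat as ℕ
open import Data.Nat.Properties
open import Algebra.Properties.CommutativeSemigroup *-commutativeSemigroup using (x∙yz≈y∙xz)
open import Data.Nat.DivMod using (m/n*n≤m)
open import Data.Nat.Tactic.RingSolver using (solve-∀)
open import Data.List using (map; []; _∷_)
open import Data.Product using (_,_)
open import Data.Unit using (tt)
open import Relation.Binary.PropositionalEquality
import Data.Integer as ℤ
import Data.Integer.Properties as ℤ

private
  variable
    g h : ℕ → ℕ

shift : (ℕ → ℕ) → ℕ → ℕ
shift g zero    = 0
shift g (suc i) = g i

shift-cong : (∀ i → g i ≡ h i) → ∀ i → shift g i ≡ shift h i
shift-cong eq zero    = refl
shift-cong eq (suc i) = eq i

shift-+ : ∀ g h i → shift (λ j → g j + h j) i ≡ shift g i + shift h i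
shift-+ g h zero    = refl
shift-+ g h (suc i) = refl

coeff-⊕ : ∀ p q i → coeff (p ⊕ q) i ≡ coeff p i + coeff q i
coeff-⊕ []      q       i       = refl
coeff-⊕ (a ∷ p) []      i       = sym (+-identityʳ _)
coeff-⊕ (a ∷ p) (b ∷ q) zero    = refl
coeff-⊕ (a ∷ p) (b ∷ q) (suc i) = coeff-⊕ p q i

coeff-map-* : ∀ a p i → coeff (map (a *_) p) i ≡ a * coeff p i
coeff-map-* a []      i       = sym (*-zeroʳ a)
coeff-map-* a (b ∷ p) zero    = refl
coeff-map-* a (b ∷ p) (suc i) = coeff-map-* a p i

coeff-0∷ : ∀ p i → coeff (0 ∷ p) i ≡ shift (coeff p) i
coeff-0∷ p zero    = refl
coeff-0∷ p (suc i) = refl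

coeff-∷-⊗ : ∀ a p q i → coeff ((a ∷ p) ⊗ q) i ≡ a * coeff q i + shift (coeff (p ⊗ q)) i
coeff-∷-⊗ a p q i = trans (coeff-⊕ (map (a *_) q) (0 ∷ (p ⊗ q)) i)
                          (cong₂ _+_ (coeff-map-* a q i) (coeff-0∷ (p ⊗ q) i))

coeff-1⊗ : ∀ p i → coeff ((1 ∷ []) ⊗ p) i ≡ coeff p i
coeff-1⊗ p zero    = trans (coeff-∷-⊗ 1 [] p 0) (trans (+-identityʳ _) (*-identityˡ _))
coeff-1⊗ p (suc i) = trans (coeff-∷-⊗ 1 [] p (suc i)) (trans (+-identityʳ _) (*-identityˡ _))

coeff-trin-⊗ : ∀ p i → coeff (trin ⊗ p) i ≡ coeff p i + shift (coeff p) i + shift (shift (coeff p)) i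
coeff-trin-⊗ p i = begin
  coeff (trin ⊗ p) i                            ≡⟨ coeff-∷-⊗ 1 (1 ∷ 1 ∷ []) p i ⟩
  1 * c i + shift (coeff ((1 ∷ 1 ∷ []) ⊗ p)) i  ≡⟨ cong₂ _+_ (*-identityˡ (c i)) (shift-cong tail i) ⟩
  c i + shift (λ j → c j + shift c j) i         ≡⟨ cong (_+_ (c i)) (shift-+ c (shift c) i) ⟩
  c i + (shift c i + shift (shift c) i)         ≡⟨ +-assoc (c i) _ _ ⟨
  c i + shift c i + shift (shift c) i           ∎
  where
  open ≡-Reasoning
  c = coeff p
  tail : ∀ j → coeff ((1 ∷ 1 ∷ []) ⊗ p) j ≡ c j + shift c j
  tail j = trans (coeff-∷-⊗ 1 (1 ∷ []) p j) (cong₂ _+_ (*-identityˡ (c j)) (shift-cong (coeff-1⊗ p) j))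

f-suc : ∀ n i → f (suc n) i ≡ f n i + shift (f n) i + shift (shift (f n)) i
f-suc n = coeff-trin-⊗ (trin ^ᵖ n)

-- weightedSum g m = Σ_{i ≤ m} 2^(m-i) g i, i.e. 2^m times the series Σ g i / 2^i truncated at m.
weightedSum : (ℕ → ℕ) → ℕ → ℕ
weightedSum g zero    = g 0
weightedSum g (suc m) = 2 * weightedSum g m + g (suc m)

weightedSum-cong : (∀ i → g i ≡ h i) → ∀ m → weightedSum g m ≡ weightedSum h m
weightedSum-cong eq zero    = eq 0
weightedSum-cong eq (suc m) = cong₂ (λ s x → 2 * s + x) (weightedSum-cong eq m) (eq (suc m))

weightedSum-+ : ∀ g h m → weightedSum (λ i → g i + h i) m ≡ weightedSum g m + weightedSum h m
weightedSum-+ g h zero    = refl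
weightedSum-+ g h (suc m) = begin
  2 * weightedSum (λ i → g i + h i) m + (g (suc m) + h (suc m))
    ≡⟨ cong (λ s → 2 * s + (g (suc m) + h (suc m))) (weightedSum-+ g h m) ⟩
  2 * (weightedSum g m + weightedSum h m) + (g (suc m) + h (suc m))
    ≡⟨ regroup (weightedSum g m) (weightedSum h m) (g (suc m)) (h (suc m)) ⟩
  (2 * weightedSum g m + g (suc m)) + (2 * weightedSum h m + h (suc m)) ∎
  where
  open ≡-Reasoning
  regroup : ∀ a b x y → 2 * (a + b) + (x + y) ≡ (2 * a + x) + (2 * b + y)
  regroup = solve-∀

weightedSum-shift : ∀ g m → weightedSum (shift g) (suc m) ≡ weightedSum g m
weightedSum-shift g zero    = refl
weightedSum-shift g (suc m) = cong (λ s → 2 * s + g (suc m)) (weightedSum-shift g m)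

sum1to-≤-weightedSum : ∀ g m → g 0 + sum1to g m ≤ weightedSum g m
sum1to-≤-weightedSum g zero    = ≤-reflexive (+-identityʳ (g 0))
sum1to-≤-weightedSum g (suc m) = begin
  g 0 + (sum1to g m + g (suc m))  ≡⟨ +-assoc (g 0) _ _ ⟨
  g 0 + sum1to g m + g (suc m)    ≤⟨ +-monoˡ-≤ (g (suc m)) (sum1to-≤-weightedSum g m) ⟩
  weightedSum g m + g (suc m)     ≤⟨ +-monoˡ-≤ (g (suc m)) (m≤n*m (weightedSum g m) 2) ⟩
  2 * weightedSum g m + g (suc m) ∎
  where open ≤-Reasoning

DyadicBound : ℕ → ℕ → (ℕ → ℕ) → Set
DyadicBound K C g = ∀ m → K * weightedSum g m ≤ C * 2 ^ m

dyadicBound-shift : ∀ {K C} → DyadicBound K C g → DyadicBound (2 * K) C (shift g)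
dyadicBound-shift {K = K} {C} bound zero = subst (_≤ C * 1) (sym (*-zeroʳ (2 * K))) z≤n
dyadicBound-shift {g = g} {K} {C} bound (suc m) = begin
  2 * K * weightedSum (shift g) (suc m) ≡⟨ cong (2 * K *_) (weightedSum-shift g m) ⟩
  2 * K * weightedSum g m               ≡⟨ *-assoc 2 K _ ⟩
  2 * (K * weightedSum g m)             ≤⟨ *-monoʳ-≤ 2 (bound m) ⟩
  2 * (C * 2 ^ m)                       ≡⟨ x∙yz≈y∙xz 2 C (2 ^ m) ⟩
  C * 2 ^ suc m                         ∎
  where open ≤-Reasoning

-- Multiplying by 1 + x + x² scales the value at x = 1/2 by 7/4.
dyadicBound-trinomial : ∀ {K C} → DyadicBound K C g →
                        DyadicBound (4 * K) (7 * C) (λ i → g i + shift g i + shift (shift g) i)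
dyadicBound-trinomial {g = g} {K} {C} bound m = begin
  4 * K * weightedSum (λ i → g i + shift g i + shift (shift g) i) m
    ≡⟨ cong (4 * K *_) split ⟩
  4 * K * (a + b + c)
    ≡⟨ regroup K a b c ⟩
  4 * (K * a) + 2 * (2 * K * b) + 2 * (2 * K) * c
    ≤⟨ +-mono-≤ (+-mono-≤ (*-monoʳ-≤ 4 (bound m)) (*-monoʳ-≤ 2 (bound₁ m))) (bound₂ m) ⟩
  4 * (C * 2 ^ m) + 2 * (C * 2 ^ m) + C * 2 ^ m
    ≡⟨ collect C (2 ^ m) ⟩
  7 * C * 2 ^ m ∎
  where
  open ≤-Reasoning
  a = weightedSum g m
  b = weightedSum (shift g) m
  c = weightedSum (shift (shift g)) m
  bound₁ : DyadicBound (2 * K) C (shift g)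
  bound₁ = dyadicBound-shift {g} {K} {C} bound
  bound₂ : DyadicBound (2 * (2 * K)) C (shift (shift g))
  bound₂ = dyadicBound-shift {shift g} {2 * K} {C} bound₁
  split : weightedSum (λ i → g i + shift g i + shift (shift g) i) m ≡ a + b + c
  split = trans (weightedSum-+ (λ i → g i + shift g i) (shift (shift g)) m)
                (cong (_+ c) (weightedSum-+ g (shift g) m))
  regroup : ∀ K a b c → 4 * K * (a + b + c) ≡ 4 * (K * a) + 2 * (2 * K * b) + 2 * (2 * K) * c
  regroup = solve-∀
  collect : ∀ C P → 4 * (C * P) + 2 * (C * P) + C * P ≡ 7 * C * P
  collect = solve-∀

weightedSum-f-zero : ∀ m → weightedSum (f 0) m ≡ 2 ^ m
weightedSum-f-zero zero    = refl
weightedSum-f-zero (suc m) = trans (+-identityʳ _) (cong (2 *_) (weightedSum-f-zero m))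

f-dyadicBound : ∀ n → DyadicBound (4 ^ n) (7 ^ n) (f n)
f-dyadicBound zero    m = ≤-reflexive (cong (1 *_) (weightedSum-f-zero m))
f-dyadicBound (suc n) m = begin
  4 ^ suc n * weightedSum (f (suc n)) m
    ≡⟨ cong (4 ^ suc n *_) (weightedSum-cong (f-suc n) m) ⟩
  4 ^ suc n * weightedSum (λ i → f n i + shift (f n) i + shift (shift (f n)) i) m
    ≤⟨ dyadicBound-trinomial {g = f n} {4 ^ n} {7 ^ n} (f-dyadicBound n) m ⟩
  7 ^ suc n * 2 ^ m ∎
  where open ≤-Reasoning

plateau : ℕ → ℕ
plateau 0 = 1
plateau 1 = 2
plateau 2 = 3
plateau 3 = 3
plateau 4 = 3
plateau 5 = 2
plateau 6 = 1
plateau _ = 0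

plateau-grows : ∀ j → 8 * plateau j ≤ 3 * (plateau (suc j) + plateau j + shift plateau j)
plateau-grows 0 = ≤ᵇ⇒≤ _ _ tt
plateau-grows 1 = ≤ᵇ⇒≤ _ _ tt
plateau-grows 2 = ≤ᵇ⇒≤ _ _ tt
plateau-grows 3 = ≤ᵇ⇒≤ _ _ tt
plateau-grows 4 = ≤ᵇ⇒≤ _ _ tt
plateau-grows 5 = ≤ᵇ⇒≤ _ _ tt
plateau-grows 6 = ≤ᵇ⇒≤ _ _ tt
plateau-grows (suc (suc (suc (suc (suc (suc (suc j))))))) = z≤n

record Dominates (P Q : ℕ) (v g : ℕ → ℕ) (a : ℕ) : Set where
  field below : ∀ j → P * v j ≤ Q * g (a + j)
open Dominates

dominates-shift : ∀ {P Q v a} → Dominates P Q v g a → ∀ j → P * shift v j ≤ Q * shift g (a + j)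
dominates-shift {g} {P} {Q} {a = a} dom zero = subst (_≤ Q * shift g (a + 0)) (sym (*-zeroʳ P)) z≤n
dominates-shift {g} {P} {Q} {v} {a} dom (suc j) =
  subst (λ i → P * v j ≤ Q * shift g i) (sym (+-suc a j)) (below dom j)

dominates-f-suc : ∀ {p q v} → (∀ j → p * v j ≤ q * (v (suc j) + v j + shift v j)) →
                  ∀ {P Q n a} → Dominates P Q v (f n) a → Dominates (p * P) (q * Q) v (f (suc n)) (suc a)
below (dominates-f-suc {p} {q} {v} grows {P} {Q} {n} {a} dom) j = begin
  p * P * v j
    ≡⟨ swap p P (v j) ⟩
  P * (p * v j)
    ≤⟨ *-monoʳ-≤ P (grows j) ⟩
  P * (q * (v (suc j) + v j + shift v j))
    ≡⟨ distribute P q (v (suc j)) (v j) (shift v j) ⟩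
  q * (P * v (suc j) + P * v j + P * shift v j)
    ≤⟨ *-monoʳ-≤ q (+-mono-≤ (+-mono-≤ next (below dom j)) (dominates-shift {f n} {P} {Q} {v} dom j)) ⟩
  q * (Q * f n (suc (a + j)) + Q * f n (a + j) + Q * shift (f n) (a + j))
    ≡⟨ collect q Q (f n (suc (a + j))) (f n (a + j)) (shift (f n) (a + j)) ⟩
  q * Q * (f n (suc (a + j)) + f n (a + j) + shift (f n) (a + j))
    ≡⟨ cong (q * Q *_) (f-suc n (suc (a + j))) ⟨
  q * Q * f (suc n) (suc a + j) ∎
  where
  open ≤-Reasoning
  next : P * v (suc j) ≤ Q * f n (suc (a + j))
  next = subst (λ i → P * v (suc j) ≤ Q * f n i) (+-suc a j) (below dom (suc j))
  swap : ∀ p P w → p * P * w ≡ P * (p * w)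
  swap = solve-∀
  distribute : ∀ P q x y z → P * (q * (x + y + z)) ≡ q * (P * x + P * y + P * z)
  distribute = solve-∀
  collect : ∀ q Q x y z → q * (Q * x + Q * y + Q * z) ≡ q * Q * (x + y + z)
  collect = solve-∀

plateau-below-f-three : Dominates 1 1 plateau (f 3) 0
below plateau-below-f-three 0 = ≤ᵇ⇒≤ _ _ tt
below plateau-below-f-three 1 = ≤ᵇ⇒≤ _ _ tt
below plateau-below-f-three 2 = ≤ᵇ⇒≤ _ _ tt
below plateau-below-f-three 3 = ≤ᵇ⇒≤ _ _ tt
below plateau-below-f-three 4 = ≤ᵇ⇒≤ _ _ tt
below plateau-below-f-three 5 = ≤ᵇ⇒≤ _ _ tt
below plateau-below-f-three 6 = ≤ᵇ⇒≤ _ _ tt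
below plateau-below-f-three (suc (suc (suc (suc (suc (suc (suc j))))))) = z≤n

plateau-below-f : ∀ k → Dominates (8 ^ k) (3 ^ k) plateau (f (k + 3)) k
plateau-below-f zero    = plateau-below-f-three
plateau-below-f (suc k) = dominates-f-suc {8} {3} plateau-grows {n = k + 3} (plateau-below-f k)

f-centre-lower : ∀ k → 8 ^ k * 3 ≤ 3 ^ k * f (k + 3) (k + 3)
f-centre-lower k = below (plateau-below-f k) 3

geometric-< : ∀ {a b} .{{_ : NonZero a}} →
              (∀ k → g (suc k) ≡ a * g k) → (∀ k → h (suc k) ≡ b * h k) → a ≤ b →
              ∀ {k₀ k} → g k₀ ℕ.< h k₀ → k₀ ℕ.≤′ k → g k ℕ.< h k
geometric-< gstep hstep a≤b base ℕ.≤′-refl = base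
geometric-< {g} {h} {a} {b} gstep hstep a≤b base (ℕ.≤′-step {k} k₀≤′k) = begin-strict
  g (suc k)  ≡⟨ gstep k ⟩
  a * g k    <⟨ *-monoʳ-< a (geometric-< gstep hstep a≤b base k₀≤′k) ⟩
  a * h k    ≤⟨ *-monoˡ-≤ (h k) a≤b ⟩
  b * h k    ≡⟨ hstep k ⟨
  h (suc k)  ∎
  where open ≤-Reasoning

upperSq : ℕ → ℕ
upperSq k = 2 * (3 ^ k * 7 ^ (k + 3)) * (2 * (3 ^ k * 7 ^ (k + 3))) * 2 ^ (k + 3)

lowerSq : ℕ → ℕ
lowerSq k = 3 * (8 ^ k * 4 ^ (k + 3)) * (3 * (8 ^ k * 4 ^ (k + 3)))

upperSq-suc : ∀ k → upperSq (suc k) ≡ 882 * upperSq k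
upperSq-suc k = ratio (3 ^ k) (7 ^ (k + 3)) (2 ^ (k + 3))
  where
  ratio : ∀ a b d → 2 * (3 * a * (7 * b)) * (2 * (3 * a * (7 * b))) * (2 * d)
                  ≡ 882 * (2 * (a * b) * (2 * (a * b)) * d)
  ratio = solve-∀

lowerSq-suc : ∀ k → lowerSq (suc k) ≡ 1024 * lowerSq k
lowerSq-suc k = ratio (8 ^ k) (4 ^ (k + 3))
  where
  ratio : ∀ a b → 3 * (8 * a * (4 * b)) * (3 * (8 * a * (4 * b))) ≡ 1024 * (3 * (a * b) * (3 * (a * b)))
  ratio = solve-∀

upperSq<lowerSq : ∀ {k} → 32 ≤ k → upperSq k ℕ.< lowerSq k
upperSq<lowerSq 32≤k =
  geometric-< {upperSq} {lowerSq} upperSq-suc lowerSq-suc (≤ᵇ⇒≤ 882 1024 tt) (≤ᵇ⇒≤ _ _ tt) (≤⇒≤′ 32≤k)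

m*m<n*n⇒m<n : ∀ {m n} → m * m ℕ.< n * n → m ℕ.< n
m*m<n*n⇒m<n m*m<n*n = ≰⇒> (λ n≤m → <⇒≱ m*m<n*n (*-mono-≤ n≤m n≤m))

2^⌊n/2⌋*2^⌊n/2⌋≤2^n : ∀ n → 2 ^ (n / 2) * 2 ^ (n / 2) ≤ 2 ^ n
2^⌊n/2⌋*2^⌊n/2⌋≤2^n n = begin
  2 ^ (n / 2) * 2 ^ (n / 2)  ≡⟨ ^-distribˡ-+-* 2 (n / 2) (n / 2) ⟨
  2 ^ (n / 2 + n / 2)        ≤⟨ ^-monoʳ-≤ 2 (≤-trans (≤-reflexive (double (n / 2))) (m/n*n≤m n 2)) ⟩
  2 ^ n                      ∎
  where
  open ≤-Reasoning
  double : ∀ x → x + x ≡ x * 2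
  double = solve-∀

+m-+n<0 : ∀ {m n} → m ℕ.< n → (+ m) ℤ.- (+ n) < + 0
+m-+n<0 {m} {n} m<n = subst ((+ m) ℤ.- (+ n) <_) (ℤ.+-inverseʳ (+ n)) (ℤ.+-monoˡ-< (ℤ.- (+ n)) (ℤ.+<+ m<n))

expr-negative : ∀ k → 32 ≤ k → expr (k + 3) < + 0
expr-negative k 32≤k = +m-+n<0 (*-cancelˡ-< X T F (m*m<n*n⇒m<n (begin-strict
  X * T * (X * T)  ≤⟨ left-≤ ⟩
  upperSq k        <⟨ upperSq<lowerSq 32≤k ⟩
  lowerSq k        ≤⟨ centre-≥ ⟩
  X * F * (X * F)  ∎)))
  where
  open ≤-Reasoning
  n = k + 3
  m = n / 2
  T = 2 * f n 0 + sum1to (f n) m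
  F = f n n
  X = 3 ^ k * 4 ^ n
  Y = 2 * (3 ^ k * 7 ^ n)
  T≤weightedSum : T ≤ 2 * weightedSum (f n) m
  T≤weightedSum = begin
    2 * f n 0 + sum1to (f n) m      ≤⟨ +-monoʳ-≤ (2 * f n 0) (m≤n*m (sum1to (f n) m) 2) ⟩
    2 * f n 0 + 2 * sum1to (f n) m  ≡⟨ *-distribˡ-+ 2 (f n 0) _ ⟨
    2 * (f n 0 + sum1to (f n) m)    ≤⟨ *-monoʳ-≤ 2 (sum1to-≤-weightedSum (f n) m) ⟩
    2 * weightedSum (f n) m         ∎
  XT≤Y2^m : X * T ≤ Y * 2 ^ m
  XT≤Y2^m = begin
    X * T                                      ≤⟨ *-monoʳ-≤ X T≤weightedSum ⟩
    X * (2 * weightedSum (f n) m)              ≡⟨ regroup (3 ^ k) (4 ^ n) (weightedSum (f n) m) ⟩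
    2 * (3 ^ k * (4 ^ n * weightedSum (f n) m)) ≤⟨ *-monoʳ-≤ 2 (*-monoʳ-≤ (3 ^ k) (f-dyadicBound n m)) ⟩
    2 * (3 ^ k * (7 ^ n * 2 ^ m))              ≡⟨ regroup′ (3 ^ k) (7 ^ n) (2 ^ m) ⟩
    Y * 2 ^ m                                  ∎
    where
    regroup : ∀ a b w → a * b * (2 * w) ≡ 2 * (a * (b * w))
    regroup = solve-∀
    regroup′ : ∀ a b P → 2 * (a * (b * P)) ≡ 2 * (a * b) * P
    regroup′ = solve-∀
  left-≤ : X * T * (X * T) ≤ upperSq k
  left-≤ = begin
    X * T * (X * T)                    ≤⟨ *-mono-≤ XT≤Y2^m XT≤Y2^m ⟩
    Y * 2 ^ m * (Y * 2 ^ m)            ≡⟨ regroup Y (2 ^ m) ⟩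
    Y * Y * (2 ^ m * 2 ^ m)            ≤⟨ *-monoʳ-≤ (Y * Y) (2^⌊n/2⌋*2^⌊n/2⌋≤2^n n) ⟩
    Y * Y * 2 ^ n                      ∎
    where
    regroup : ∀ y P → y * P * (y * P) ≡ y * y * (P * P)
    regroup = solve-∀
  3·8^k·4^n≤XF : 3 * (8 ^ k * 4 ^ n) ≤ X * F
  3·8^k·4^n≤XF = begin
    3 * (8 ^ k * 4 ^ n)  ≡⟨ regroup (8 ^ k) (4 ^ n) ⟩
    4 ^ n * (8 ^ k * 3)  ≤⟨ *-monoʳ-≤ (4 ^ n) (f-centre-lower k) ⟩
    4 ^ n * (3 ^ k * F)  ≡⟨ regroup′ (3 ^ k) (4 ^ n) F ⟩
    X * F                ∎
    where
    regroup : ∀ a b → 3 * (a * b) ≡ b * (a * 3)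
    regroup = solve-∀
    regroup′ : ∀ a b x → b * (a * x) ≡ a * b * x
    regroup′ = solve-∀
  centre-≥ : lowerSq k ≤ X * F * (X * F)
  centre-≥ = *-mono-≤ 3·8^k·4^n≤XF 3·8^k·4^n≤XF

lemma3p5 : ∃[ N ] ((n : ℕ) → n ≥ N → n ≥ 1 → expr n < + 0)
lemma3p5 = 35 , λ n 35≤n _ →
  subst (λ n → expr n < + 0)
        (m∸n+n≡m (≤-trans (≤ᵇ⇒≤ 3 35 tt) 35≤n))
        (expr-negative (n ∸ 3) (∸-monoˡ-≤ 3 35≤n))
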